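{- Let $\mathcal{X}$ and $\mathcal{A}$ be concretely order-regular categories and $F:\mathcal{X}\to\mathcal{A}$ a contravariant functor such that $(Fq)^\ast\cdot(Fp)_\ast=(Fg)_\ast\cdot(Ff)^\ast$ for every exact square $p:W\to A_1$, $q:W\to A_2$, $f:A_1\to C$, $g:A_2\to C$ in $\mathcal{X}$, and such that $F$ takes surjections to embeddings. Then $F$ extends uniquely to a (covariant) functor $\overline F:\mathsf{Rel}(\mathcal{X})^{\mathrm{co}}\to\mathsf{Rel}(\mathcal{A})$ (extending in the sense $\overline F(f_\ast)=(Ff)^\ast$). A relation $r:X\looparrowright Y$ is mapped to $\overline F r:FX\looparrowright FY$ given by $(a,b)\in\overline F r$ iff $Fp(a)\le Fq(b)$ in $FW$, where $(p:W\to X,q:W\to Y)$ is a tabulation of $r$; $\overline Fr$ is tabulated by the comma object of the cospan $(Fp,Fq)$. If $r=f_\ast$ for some $f:X\to Y$, this simplifies to $(a,b)\in\overline F(f_\ast)$ iff $a\le Ff(b)$ in $FX$.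
   Context: A concretely order-regular category is a locally monotone functor $U:\mathcal{C}\to\mathsf{Pos}$ from a poset-enriched category, order-preserving and order-reflecting on homsets, with $\mathcal{C}$ having and $U$ preserving finite poset-enriched (weighted) limits (including comma objects), and with a factorisation system $(\mathcal{E},\mathcal{M})$ lifting uniquely the (surjection, order-embedding) factorisations ($U\mathcal{E}$ = surjections, $U\mathcal{M}$ = embeddings); surjections/embeddings in $\mathcal{C}$ are arrows whose $U$-image is one. A weakening relation $R:A\looparrowright B$ of posets is a subset with $a'\le aRb\le b'\Rightarrow a'Rb'$; composition $S\cdot R$ is relational ($R$ first). For $f:A\to B$: $f_\ast=\{(a,b)\mid f(a)\le b\}$, $f^\ast=\{(b,a)\mid b\le f(a)\}$. A $\mathcal{C}$-relation $A\looparrowright B$ is a weakening relation $UA\looparrowright UB$ whose graph with projections is the $U$-image of a span in $\mathcal{C}$ (said to tabulate it). $\mathsf{Rel}(\mathcal{C})$: objects of $\mathcal{C}$, $\mathcal{C}$-relations, inclusion order; $^{\mathrm{co}}$ reverses the order of homsets. A square $p:W\to A_1,q:W\to A_2,f:A_1\to C,g:A_2\to C$ is exact if $fp\le gq$ and whenever $Uf(x)\le Ug(y)$ there is $w$ with $x\le Up(w)$, $Uq(w)\le y$. -}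

module Defs where

open import Level using (Level; _⊔_) renaming (suc to lsuc)
open import Relation.Binary.Bundles using (Poset)
open import Relation.Binary.Structures using (IsPartialOrder)
open import Data.Product using (Σ; _×_; _,_; proj₁; proj₂; Σ-syntax)

_iff_ : ∀ {a b} → Set a → Set b → Set (a ⊔ b)
P iff Q = (P → Q) × (Q → P)

∣_∣ : ∀ {c} → Poset c c c → Set c
∣ P ∣ = Poset.Carrier P

module _ {c : Level} (P Q : Poset c c c) where
  private
    module P = Poset P
    module Q = Poset Q

  IsSurjective : (∣ P ∣ → ∣ Q ∣) → Set c
  IsSurjective f = ∀ y → Σ[ x ∈ ∣ P ∣ ] (f x Q.≈ y)

  -- order-embedding in Pos (for a monotone map: order-reflecting)
  IsOrderEmbedding : (∣ P ∣ → ∣ Q ∣) → Set c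
  IsOrderEmbedding f = ∀ x x' → f x Q.≤ f x' → x P.≤ x'

  PRel : Set (lsuc c)
  PRel = ∣ P ∣ → ∣ Q ∣ → Set c

  IsWeakening : PRel → Set c
  IsWeakening R = ∀ {a a' b b'} → a' P.≤ a → R a b → b Q.≤ b' → R a' b'

  _⊆_ : PRel → PRel → Set c
  R ⊆ S = ∀ a b → R a b → S a b

  _≃_ : PRel → PRel → Set c
  R ≃ S = (R ⊆ S) × (S ⊆ R)

-- relational composition  S · R  (R first)
_·_ : ∀ {c} {P Q T : Poset c c c} → PRel Q T → PRel P Q → PRel P T
_·_ {Q = Q} S R = λ a c → Σ[ b ∈ ∣ Q ∣ ] (R a b × S b c)

idRel : ∀ {c} (P : Poset c c c) → PRel P P
idRel P = Poset._≤_ P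

lowerStar : ∀ {c} (P Q : Poset c c c) → (∣ P ∣ → ∣ Q ∣) → PRel P Q
lowerStar P Q f = λ a b → Poset._≤_ Q (f a) b

upperStar : ∀ {c} (P Q : Poset c c c) → (∣ P ∣ → ∣ Q ∣) → PRel Q P
upperStar P Q f = λ b a → Poset._≤_ Q b (f a)

record PosCat (o ℓ : Level) : Set (lsuc (o ⊔ ℓ)) where
  infixr 9 _∘_
  infix 4 _≈_ _≤_
  field
    Obj : Set o
    Hom : Obj → Obj → Set ℓ
    _≈_ : ∀ {A B} → Hom A B → Hom A B → Set ℓ
    _≤_ : ∀ {A B} → Hom A B → Hom A B → Set ℓ
    isPartialOrder : ∀ {A B} → IsPartialOrder (_≈_ {A} {B}) (_≤_ {A} {B})
    id : ∀ {A} → Hom A A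
    _∘_ : ∀ {A B C} → Hom B C → Hom A B → Hom A C
    ∘-resp-≈ : ∀ {A B C} {f f' : Hom B C} {g g' : Hom A B} →
               f ≈ f' → g ≈ g' → f ∘ g ≈ f' ∘ g'
    ∘-mono : ∀ {A B C} {f f' : Hom B C} {g g' : Hom A B} →
             f ≤ f' → g ≤ g' → f ∘ g ≤ f' ∘ g'
    identityˡ : ∀ {A B} {f : Hom A B} → id ∘ f ≈ f
    identityʳ : ∀ {A B} {f : Hom A B} → f ∘ id ≈ f
    assoc : ∀ {A B C D} {f : Hom A B} {g : Hom B C} {h : Hom C D} →
            (h ∘ g) ∘ f ≈ h ∘ (g ∘ f)

record Concrete {o ℓ} (C : PosCat o ℓ) : Set (lsuc (o ⊔ ℓ)) where
  open PosCat C
  field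
    U₀ : Obj → Poset ℓ ℓ ℓ
    U₁ : ∀ {A B} → Hom A B → ∣ U₀ A ∣ → ∣ U₀ B ∣
    U₁-mono : ∀ {A B} (f : Hom A B) {x y : ∣ U₀ A ∣} →
              Poset._≤_ (U₀ A) x y → Poset._≤_ (U₀ B) (U₁ f x) (U₁ f y)
    U₁-cong : ∀ {A B} (f : Hom A B) {x y : ∣ U₀ A ∣} →
              Poset._≈_ (U₀ A) x y → Poset._≈_ (U₀ B) (U₁ f x) (U₁ f y)
    U-id : ∀ {A} (x : ∣ U₀ A ∣) → Poset._≈_ (U₀ A) (U₁ id x) x
    U-∘ : ∀ {A B C} (g : Hom B C) (f : Hom A B) (x : ∣ U₀ A ∣) →
          Poset._≈_ (U₀ C) (U₁ (g ∘ f) x) (U₁ g (U₁ f x))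
    U-preserves-≤ : ∀ {A B} {f g : Hom A B} → f ≤ g →
                    ∀ x → Poset._≤_ (U₀ B) (U₁ f x) (U₁ g x)
    U-reflects-≤ : ∀ {A B} {f g : Hom A B} →
                   (∀ x → Poset._≤_ (U₀ B) (U₁ f x) (U₁ g x)) → f ≤ g

  Surj : ∀ {A B} → Hom A B → Set ℓ
  Surj {A} {B} f = IsSurjective (U₀ A) (U₀ B) (U₁ f)

  Emb : ∀ {A B} → Hom A B → Set ℓ
  Emb {A} {B} f = IsOrderEmbedding (U₀ A) (U₀ B) (U₁ f)

  -- a span (p : W → A, q : W → B) tabulates a relation R : UA ⇸ UB:
  -- w ↦ (Up w , Uq w) is an order-isomorphism from UW onto the graph of R
  -- (the graph carrying the order induced from UA × UB)
  Tabulates : ∀ {A B W} → PRel (U₀ A) (U₀ B) → Hom W A → Hom W B → Set ℓ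
  Tabulates {A} {B} {W} R p q =
    (∀ (w : ∣ U₀ W ∣) → R (U₁ p w) (U₁ q w)) ×
    (∀ a b → R a b → Σ[ w ∈ ∣ U₀ W ∣ ]
         (Poset._≈_ (U₀ A) (U₁ p w) a × Poset._≈_ (U₀ B) (U₁ q w) b)) ×
    (∀ (w w' : ∣ U₀ W ∣) → Poset._≤_ (U₀ A) (U₁ p w) (U₁ p w') →
         Poset._≤_ (U₀ B) (U₁ q w) (U₁ q w') → Poset._≤_ (U₀ W) w w')

  IsCRel : ∀ {A B} → PRel (U₀ A) (U₀ B) → Set (o ⊔ ℓ)
  IsCRel {A} {B} R =
    IsWeakening (U₀ A) (U₀ B) R × Σ[ W ∈ Obj ] Σ[ p ∈ Hom W A ] Σ[ q ∈ Hom W B ] Tabulates R p q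

  CRel : Obj → Obj → Set (lsuc ℓ ⊔ o)
  CRel A B = Σ[ R ∈ PRel (U₀ A) (U₀ B) ] IsCRel R

module Limits {o ℓ} (C : PosCat o ℓ) where
  open PosCat C

  IsTerminal : Obj → Set (o ⊔ ℓ)
  IsTerminal T = ∀ A → Σ[ h ∈ Hom A T ] (∀ (h' : Hom A T) → h' ≈ h)

  IsPullback : ∀ {A B D P} → Hom A D → Hom B D → Hom P A → Hom P B → Set (o ⊔ ℓ)
  IsPullback {A} {B} {D} {P} f g p q =
    (f ∘ p ≈ g ∘ q) ×
    (∀ {X} (h : Hom X A) (k : Hom X B) → f ∘ h ≈ g ∘ k →
       Σ[ u ∈ Hom X P ] ((p ∘ u ≈ h × q ∘ u ≈ k) ×
         (∀ (u' : Hom X P) → p ∘ u' ≈ h → q ∘ u' ≈ k → u' ≈ u))) ×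
    (∀ {X} (u v : Hom X P) → p ∘ u ≤ p ∘ v → q ∘ u ≤ q ∘ v → u ≤ v)

  IsComma : ∀ {A B D K} → Hom A D → Hom B D → Hom K A → Hom K B → Set (o ⊔ ℓ)
  IsComma {A} {B} {D} {K} f g p q =
    (f ∘ p ≤ g ∘ q) ×
    (∀ {X} (h : Hom X A) (k : Hom X B) → f ∘ h ≤ g ∘ k →
       Σ[ u ∈ Hom X K ] ((p ∘ u ≈ h × q ∘ u ≈ k) ×
         (∀ (u' : Hom X K) → p ∘ u' ≈ h → q ∘ u' ≈ k → u' ≈ u))) ×
    (∀ {X} (u v : Hom X K) → p ∘ u ≤ p ∘ v → q ∘ u ≤ q ∘ v → u ≤ v)

record OrderRegular (o ℓ : Level) : Set (lsuc (o ⊔ ℓ)) where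
  field
    cat : PosCat o ℓ
    concrete : Concrete cat
  open PosCat cat public
  open Concrete concrete public
  open Limits cat public
  field
    terminal : Σ[ T ∈ Obj ] IsTerminal T
    pullback : ∀ {A B D} (f : Hom A D) (g : Hom B D) →
               Σ[ P ∈ Obj ] Σ[ p ∈ Hom P A ] Σ[ q ∈ Hom P B ] IsPullback f g p q
    comma : ∀ {A B D} (f : Hom A D) (g : Hom B D) →
            Σ[ K ∈ Obj ] Σ[ p ∈ Hom K A ] Σ[ q ∈ Hom K B ] IsComma f g p q
    U-terminal : ∀ {T} → IsTerminal T →
                 Σ[ t ∈ ∣ U₀ T ∣ ] (∀ x → Poset._≈_ (U₀ T) x t)
    U-pullback : ∀ {A B D P} {f : Hom A D} {g : Hom B D} {p : Hom P A} {q : Hom P B} →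
                 IsPullback f g p q →
                 Tabulates (λ a b → Poset._≈_ (U₀ D) (U₁ f a) (U₁ g b)) p q
    U-comma : ∀ {A B D K} {f : Hom A D} {g : Hom B D} {p : Hom K A} {q : Hom K B} →
              IsComma f g p q →
              Tabulates (λ a b → Poset._≤_ (U₀ D) (U₁ f a) (U₁ g b)) p q
    factorise : ∀ {A B} (f : Hom A B) →
                Σ[ M ∈ Obj ] Σ[ e ∈ Hom A M ] Σ[ m ∈ Hom M B ]
                  (Surj e × Emb m × m ∘ e ≈ f)
    diagonal : ∀ {A B C D} (e : Hom A B) (m : Hom C D) (u : Hom A C) (v : Hom B D) →
               Surj e → Emb m → m ∘ u ≈ v ∘ e →
               Σ[ d ∈ Hom B C ] ((d ∘ e ≈ u × m ∘ d ≈ v) ×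
                 (∀ (d' : Hom B C) → d' ∘ e ≈ u → m ∘ d' ≈ v → d' ≈ d))

record ContraFunctor {o ℓ} (X A : OrderRegular o ℓ) : Set (o ⊔ ℓ) where
  private
    module X = OrderRegular X
    module A = OrderRegular A
  field
    F₀ : X.Obj → A.Obj
    F₁ : ∀ {B C} → X.Hom B C → A.Hom (F₀ C) (F₀ B)
    F-id : ∀ {B} → F₁ (X.id {B}) A.≈ A.id
    F-∘ : ∀ {B C D} (g : X.Hom C D) (f : X.Hom B C) → F₁ (g X.∘ f) A.≈ F₁ f A.∘ F₁ g
    F-cong : ∀ {B C} {f g : X.Hom B C} → f X.≈ g → F₁ f A.≈ F₁ g
    F-mono : ∀ {B C} {f g : X.Hom B C} → f X.≤ g → F₁ f A.≤ F₁ g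

module _ {o ℓ} {X A : OrderRegular o ℓ} (F : ContraFunctor X A) where
  private
    module X = OrderRegular X
    module A = OrderRegular A
  open ContraFunctor F

  IsExact : ∀ {W A₁ A₂ C} → X.Hom W A₁ → X.Hom W A₂ → X.Hom A₁ C → X.Hom A₂ C → Set ℓ
  IsExact {W} {A₁} {A₂} {C} p q f g =
    (f X.∘ p X.≤ g X.∘ q) ×
    (∀ x y → Poset._≤_ (X.U₀ C) (X.U₁ f x) (X.U₁ g y) →
       Σ[ w ∈ ∣ X.U₀ W ∣ ] (Poset._≤_ (X.U₀ A₁) x (X.U₁ p w) ×
                             Poset._≤_ (X.U₀ A₂) (X.U₁ q w) y))

  PreservesExact : Set (o ⊔ ℓ)
  PreservesExact =
    ∀ {W A₁ A₂ C} (p : X.Hom W A₁) (q : X.Hom W A₂) (f : X.Hom A₁ C) (g : X.Hom A₂ C) →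
    IsExact p q f g →
    _≃_ (A.U₀ (F₀ A₁)) (A.U₀ (F₀ A₂))
      (_·_ {P = A.U₀ (F₀ A₁)} {Q = A.U₀ (F₀ W)} {T = A.U₀ (F₀ A₂)}
        (upperStar (A.U₀ (F₀ A₂)) (A.U₀ (F₀ W)) (A.U₁ (F₁ q)))
        (lowerStar (A.U₀ (F₀ A₁)) (A.U₀ (F₀ W)) (A.U₁ (F₁ p))))
      (_·_ {P = A.U₀ (F₀ A₁)} {Q = A.U₀ (F₀ C)} {T = A.U₀ (F₀ A₂)}
        (lowerStar (A.U₀ (F₀ C)) (A.U₀ (F₀ A₂)) (A.U₁ (F₁ g)))
        (upperStar (A.U₀ (F₀ C)) (A.U₀ (F₀ A₁)) (A.U₁ (F₁ f))))

  SurjToEmb : Set (o ⊔ ℓ)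
  SurjToEmb = ∀ {B C} (f : X.Hom B C) → X.Surj f → A.Emb (F₁ f)

  RelMap : Set (lsuc ℓ ⊔ o)
  RelMap = ∀ {B C} (R : PRel (X.U₀ B) (X.U₀ C)) → X.IsCRel R → A.CRel (F₀ B) (F₀ C)

  -- G is a (locally monotone) functor Rel(X)^co → Rel(A) extending F,
  -- i.e. G (f_*) = (F f)^*.  Composites/identities are compared up to
  -- equality (≃) of relations.
  record IsExtension (G : RelMap) : Set (lsuc ℓ ⊔ o) where
    field
      mono : ∀ {B C} (R R' : PRel (X.U₀ B) (X.U₀ C)) (r : X.IsCRel R) (r' : X.IsCRel R') →
             _⊆_ (X.U₀ B) (X.U₀ C) R R' →
             _⊆_ (A.U₀ (F₀ B)) (A.U₀ (F₀ C)) (proj₁ (G R' r')) (proj₁ (G R r))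
      pres-id : ∀ {B} (R : PRel (X.U₀ B) (X.U₀ B)) (r : X.IsCRel R) →
                _≃_ (X.U₀ B) (X.U₀ B) R (idRel (X.U₀ B)) →
                _≃_ (A.U₀ (F₀ B)) (A.U₀ (F₀ B)) (proj₁ (G R r)) (idRel (A.U₀ (F₀ B)))
      pres-∘ : ∀ {B C D} (R : PRel (X.U₀ B) (X.U₀ C)) (S : PRel (X.U₀ C) (X.U₀ D))
               (T : PRel (X.U₀ B) (X.U₀ D))
               (r : X.IsCRel R) (s : X.IsCRel S) (t : X.IsCRel T) →
               _≃_ (X.U₀ B) (X.U₀ D) T (_·_ {P = X.U₀ B} {Q = X.U₀ C} {T = X.U₀ D} S R) →
               _≃_ (A.U₀ (F₀ B)) (A.U₀ (F₀ D)) (proj₁ (G T t))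
                 (_·_ {P = A.U₀ (F₀ B)} {Q = A.U₀ (F₀ C)} {T = A.U₀ (F₀ D)}
                   (proj₁ (G S s)) (proj₁ (G R r)))
      extends : ∀ {B C} (f : X.Hom B C) (R : PRel (X.U₀ B) (X.U₀ C)) (r : X.IsCRel R) →
                _≃_ (X.U₀ B) (X.U₀ C) R (lowerStar (X.U₀ B) (X.U₀ C) (X.U₁ f)) →
                _≃_ (A.U₀ (F₀ B)) (A.U₀ (F₀ C)) (proj₁ (G R r))
                  (upperStar (A.U₀ (F₀ C)) (A.U₀ (F₀ B)) (A.U₁ (F₁ f)))

  Described : RelMap → Set (lsuc ℓ ⊔ o)
  Described G =
    ∀ {B C} (R : PRel (X.U₀ B) (X.U₀ C)) (r : X.IsCRel R)
      {W} (p : X.Hom W B) (q : X.Hom W C) → X.Tabulates R p q →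
      ∀ a b → proj₁ (G R r) a b iff
              Poset._≤_ (A.U₀ (F₀ W)) (A.U₁ (F₁ p) a) (A.U₁ (F₁ q) b)

  CommaTabulated : RelMap → Set (lsuc ℓ ⊔ o)
  CommaTabulated G =
    ∀ {B C} (R : PRel (X.U₀ B) (X.U₀ C)) (r : X.IsCRel R)
      {W} (p : X.Hom W B) (q : X.Hom W C) → X.Tabulates R p q →
      ∀ {K} (k₁ : A.Hom K (F₀ B)) (k₂ : A.Hom K (F₀ C)) →
      A.IsComma (F₁ p) (F₁ q) k₁ k₂ → A.Tabulates (proj₁ (G R r)) k₁ k₂

  LowerStarDescribed : RelMap → Set (lsuc ℓ ⊔ o)
  LowerStarDescribed G =
    ∀ {B C} (f : X.Hom B C) (R : PRel (X.U₀ B) (X.U₀ C)) (r : X.IsCRel R) →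
    _≃_ (X.U₀ B) (X.U₀ C) R (lowerStar (X.U₀ B) (X.U₀ C) (X.U₁ f)) →
    ∀ a b → proj₁ (G R r) a b iff Poset._≤_ (A.U₀ (F₀ B)) a (A.U₁ (F₁ f) b)

-- A relation r with tabulation (p , q) is the composite q₊ · p⁺.  Any functor on relations
-- extending F sends the adjunction p₊ ⊣ p⁺ to an adjunction whose left adjoint is (F p)⁺, so
-- it must send p⁺ to (F p)₊ and r to (F q)⁺ · (F p)₊, i.e. to the comma relation
-- F p a ≤ F q b.  Conversely, this formula is monotone in r (hence independent of the
-- tabulation): if the span (t₁ , t₂) lies in the relation generated by (u , v), the object of
-- witnesses σ : L → V is a surjection, so F σ is an embedding and carries F u a ≤ F v d over to
-- F t₁ a ≤ F t₂ d.  A composite s · r is tabulated through the comma object of the inner legs,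
-- whose square is exact, and the hypothesis on exact squares is then exactly functoriality.
module Submission where

open import Defs
open import Level using (Level; _⊔_)
open import Data.Product using (_×_; _,_; proj₁; proj₂; Σ-syntax)
open import Relation.Binary.Bundles using (Poset)
open import Relation.Binary.Structures using (IsPartialOrder)
import Relation.Binary.Reasoning.PartialOrder as PosetReasoning

module OrderRegularProperties {o ℓ} (𝒞 : OrderRegular o ℓ) where
  open OrderRegular 𝒞 public

  infix 4 _≤ᵤ_ _≈ᵤ_ _⊆ᵤ_ _≃ᵤ_
  infixr 9 _·ᵤ_
  infix 10 _₊ _⁺

  _≤ᵤ_ : ∀ {B} → ∣ U₀ B ∣ → ∣ U₀ B ∣ → Set ℓ
  _≤ᵤ_ {B} = Poset._≤_ (U₀ B)

  _≈ᵤ_ : ∀ {B} → ∣ U₀ B ∣ → ∣ U₀ B ∣ → Set ℓ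
  _≈ᵤ_ {B} = Poset._≈_ (U₀ B)

  module _ {B : Obj} where
    open Poset (U₀ B) public
      using ()
      renaming (refl to ≤-refl; trans to ≤-trans; reflexive to ≤-reflexive; antisym to ≤-antisym)
    open Poset.Eq (U₀ B) public
      using ()
      renaming (refl to ≈-refl; sym to ≈-sym; trans to ≈-trans)

  module ≤-Reasoning {B : Obj} = PosetReasoning (U₀ B)

  ≥-reflexive : ∀ {B} {x y : ∣ U₀ B ∣} → x ≈ᵤ y → y ≤ᵤ x
  ≥-reflexive x≈y = ≤-reflexive (≈-sym x≈y)

  private
    module HomOrder {A B : Obj} = IsPartialOrder (isPartialOrder {A} {B})

  U₁-resp-≈ : ∀ {A B} {f g : Hom A B} → f ≈ g → ∀ x → U₁ f x ≈ᵤ U₁ g x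
  U₁-resp-≈ f≈g x = ≤-antisym (U-preserves-≤ (HomOrder.reflexive f≈g) x)
                              (U-preserves-≤ (HomOrder.reflexive (HomOrder.Eq.sym f≈g)) x)

  U₁-∘-≈ : ∀ {A B D} (g : Hom B D) (f : Hom A B) {x y} → U₁ f x ≈ᵤ y → U₁ (g ∘ f) x ≈ᵤ U₁ g y
  U₁-∘-≈ g f {x} fx≈y = ≈-trans (U-∘ g f x) (U₁-cong g fx≈y)

  ∘-≤-pointwise : ∀ {A B B' D} {f : Hom A B} {g : Hom B D} {f' : Hom A B'} {g' : Hom B' D} →
                  (∀ x → U₁ g (U₁ f x) ≤ᵤ U₁ g' (U₁ f' x)) → g ∘ f ≤ g' ∘ f'
  ∘-≤-pointwise {f = f} {g} {f'} {g'} le = U-reflects-≤ λ x →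
    ≤-trans (≤-reflexive (U-∘ g f x)) (≤-trans (le x) (≥-reflexive (U-∘ g' f' x)))

  _⊆ᵤ_ : ∀ {B D} → PRel (U₀ B) (U₀ D) → PRel (U₀ B) (U₀ D) → Set ℓ
  _⊆ᵤ_ {B} {D} = _⊆_ (U₀ B) (U₀ D)

  _≃ᵤ_ : ∀ {B D} → PRel (U₀ B) (U₀ D) → PRel (U₀ B) (U₀ D) → Set ℓ
  _≃ᵤ_ {B} {D} = _≃_ (U₀ B) (U₀ D)

  ≃-refl : ∀ {B D} {R : PRel (U₀ B) (U₀ D)} → R ≃ᵤ R
  ≃-refl = (λ _ _ x → x) , (λ _ _ x → x)

  ≃-sym : ∀ {B D} {R S : PRel (U₀ B) (U₀ D)} → R ≃ᵤ S → S ≃ᵤ R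
  ≃-sym (R⊆S , S⊆R) = S⊆R , R⊆S

  ≃-trans : ∀ {B D} {R S T : PRel (U₀ B) (U₀ D)} → R ≃ᵤ S → S ≃ᵤ T → R ≃ᵤ T
  ≃-trans (R⊆S , S⊆R) (S⊆T , T⊆S) =
    (λ a b x → S⊆T a b (R⊆S a b x)) , (λ a b x → S⊆R a b (T⊆S a b x))

  _·ᵤ_ : ∀ {B C D} → PRel (U₀ C) (U₀ D) → PRel (U₀ B) (U₀ C) → PRel (U₀ B) (U₀ D)
  _·ᵤ_ {B} {C} {D} = _·_ {P = U₀ B} {Q = U₀ C} {T = U₀ D}

  ·-cong : ∀ {B C D} {R R' : PRel (U₀ B) (U₀ C)} {S S' : PRel (U₀ C) (U₀ D)} →
           R ≃ᵤ R' → S ≃ᵤ S' → S ·ᵤ R ≃ᵤ S' ·ᵤ R'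
  ·-cong (R⊆R' , R'⊆R) (S⊆S' , S'⊆S) =
    (λ a d (c , r , s) → c , R⊆R' a c r , S⊆S' c d s) ,
    (λ a d (c , r , s) → c , R'⊆R a c r , S'⊆S c d s)

  _₊ : ∀ {B D} → Hom B D → PRel (U₀ B) (U₀ D)
  _₊ {B} {D} f = lowerStar (U₀ B) (U₀ D) (U₁ f)

  _⁺ : ∀ {B D} → Hom B D → PRel (U₀ D) (U₀ B)
  _⁺ {B} {D} f = upperStar (U₀ B) (U₀ D) (U₁ f)

  commaRel : ∀ {B D E} → Hom B E → Hom D E → PRel (U₀ B) (U₀ D)
  commaRel f g a b = U₁ f a ≤ᵤ U₁ g b

  spanRel : ∀ {K B D} → Hom K B → Hom K D → PRel (U₀ B) (U₀ D)
  spanRel u v = v ₊ ·ᵤ u ⁺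

  SpanIn : ∀ {K B D} → PRel (U₀ B) (U₀ D) → Hom K B → Hom K D → Set ℓ
  SpanIn R u v = ∀ k → R (U₁ u k) (U₁ v k)

  ⁺·₊-≃-commaRel : ∀ {B D E} (f : Hom B E) (g : Hom D E) → g ⁺ ·ᵤ f ₊ ≃ᵤ commaRel f g
  ⁺·₊-≃-commaRel f g = (λ a b (c , fa≤c , c≤gb) → ≤-trans fa≤c c≤gb) ,
                       (λ a b fa≤gb → U₁ f a , ≤-refl , fa≤gb)

  id₊-≃-idRel : ∀ {B} → id {B} ₊ ≃ᵤ idRel (U₀ B)
  id₊-≃-idRel = (λ a b ida≤b → ≤-trans (≥-reflexive (U-id a)) ida≤b) ,
                (λ a b a≤b → ≤-trans (≤-reflexive (U-id a)) a≤b)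

  spanRel-refl : ∀ {K B D} (u : Hom K B) (v : Hom K D) → SpanIn (spanRel u v) u v
  spanRel-refl u v k = k , ≤-refl , ≤-refl

  spanRel-weakening : ∀ {K B D} (u : Hom K B) (v : Hom K D) → IsWeakening (U₀ B) (U₀ D) (spanRel u v)
  spanRel-weakening u v a'≤a (k , a≤uk , vk≤b) b≤b' = k , ≤-trans a'≤a a≤uk , ≤-trans vk≤b b≤b'

  ₊-≃-spanRel : ∀ {B D} (f : Hom B D) → f ₊ ≃ᵤ spanRel id f
  ₊-≃-spanRel f = (λ b d fb≤d → b , ≥-reflexive (U-id b) , fb≤d) ,
                  (λ b d (k , b≤k , fk≤d) → ≤-trans (U₁-mono f (≤-trans b≤k (≤-reflexive (U-id k)))) fk≤d)

  ⁺-≃-spanRel : ∀ {B D} (f : Hom B D) → f ⁺ ≃ᵤ spanRel f id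
  ⁺-≃-spanRel f = (λ d b d≤fb → b , d≤fb , ≤-reflexive (U-id b)) ,
                  (λ d b (k , d≤fk , k≤b) → ≤-trans d≤fk (U₁-mono f (≤-trans (≥-reflexive (U-id k)) k≤b)))

  tabulated⊆spanRel : ∀ {W B D} {R : PRel (U₀ B) (U₀ D)} {p : Hom W B} {q : Hom W D} →
                      Tabulates R p q → R ⊆ᵤ spanRel p q
  tabulated⊆spanRel (_ , onto , _) b d r with onto b d r
  ... | w , pw≈b , qw≈d = w , ≥-reflexive pw≈b , ≤-reflexive qw≈d

  spanRel⊆ : ∀ {K B D} {R : PRel (U₀ B) (U₀ D)} {u : Hom K B} {v : Hom K D} →
             IsWeakening (U₀ B) (U₀ D) R → SpanIn R u v → spanRel u v ⊆ᵤ R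
  spanRel⊆ weak uv∈R b d (k , b≤uk , vk≤d) = weak b≤uk (uv∈R k) vk≤d

  tabulated-≃-spanRel : ∀ {W B D} {R : PRel (U₀ B) (U₀ D)} {p : Hom W B} {q : Hom W D} →
                        IsWeakening (U₀ B) (U₀ D) R → Tabulates R p q → R ≃ᵤ spanRel p q
  tabulated-≃-spanRel weak tab = tabulated⊆spanRel tab , spanRel⊆ weak (proj₁ tab)

  Tabulates-resp-≃ : ∀ {W B D} {R S : PRel (U₀ B) (U₀ D)} {p : Hom W B} {q : Hom W D} →
                     R ≃ᵤ S → Tabulates R p q → Tabulates S p q
  Tabulates-resp-≃ (R⊆S , S⊆R) (pq∈R , onto , reflect) =
    (λ w → R⊆S _ _ (pq∈R w)) , (λ b d s → onto b d (S⊆R b d s)) , reflect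

  isCRel-resp-≃ : ∀ {B D} {R S : PRel (U₀ B) (U₀ D)} → R ≃ᵤ S → IsCRel R → IsCRel S
  isCRel-resp-≃ (R⊆S , S⊆R) (weak , W , p , q , tab) =
    (λ a'≤a s b≤b' → R⊆S _ _ (weak a'≤a (S⊆R _ _ s) b≤b')) ,
    W , p , q , Tabulates-resp-≃ (R⊆S , S⊆R) tab

  private
    ⊤ : Obj
    ⊤ = proj₁ terminal

    ! : ∀ {Y} → Hom Y ⊤
    ! {Y} = proj₁ (proj₂ terminal Y)

    !-unique : ∀ {Y} (f g : Hom Y ⊤) → f ≈ g
    !-unique {Y} f g = HomOrder.Eq.trans (proj₂ (proj₂ terminal Y) f)
                                         (HomOrder.Eq.sym (proj₂ (proj₂ terminal Y) g))

    ⊤-points-≈ : (x y : ∣ U₀ ⊤ ∣) → x ≈ᵤ y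
    ⊤-points-≈ x y with U-terminal (proj₂ terminal)
    ... | _ , ≈-point = ≈-trans (≈-point x) (≈-sym (≈-point y))

  record BinaryProduct (Y Z : Obj) : Set (o ⊔ ℓ) where
    field
      P : Obj
      π₁ : Hom P Y
      π₂ : Hom P Z
      pair : ∀ {W} → Hom W Y → Hom W Z → Hom W P
      π₁-pair : ∀ {W} (f : Hom W Y) (g : Hom W Z) w → U₁ π₁ (U₁ (pair f g) w) ≈ᵤ U₁ f w
      π₂-pair : ∀ {W} (f : Hom W Y) (g : Hom W Z) w → U₁ π₂ (U₁ (pair f g) w) ≈ᵤ U₁ g w
      point : ∀ y z → Σ[ x ∈ ∣ U₀ P ∣ ] (U₁ π₁ x ≈ᵤ y × U₁ π₂ x ≈ᵤ z)
      π-reflect : ∀ x x' → U₁ π₁ x ≤ᵤ U₁ π₁ x' → U₁ π₂ x ≤ᵤ U₁ π₂ x' → x ≤ᵤ x'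

    π-≈-reflect : ∀ x x' → U₁ π₁ x ≈ᵤ U₁ π₁ x' → U₁ π₂ x ≈ᵤ U₁ π₂ x' → x ≈ᵤ x'
    π-≈-reflect x x' e₁ e₂ = ≤-antisym (π-reflect x x' (≤-reflexive e₁) (≤-reflexive e₂))
                                       (π-reflect x' x (≥-reflexive e₁) (≥-reflexive e₂))

    U-pair-≈ : ∀ {W W'} (f : Hom W Y) (g : Hom W Z) (f' : Hom W' Y) (g' : Hom W' Z) w w' →
               (U₁ (pair f g) w ≈ᵤ U₁ (pair f' g') w') iff (U₁ f w ≈ᵤ U₁ f' w' × U₁ g w ≈ᵤ U₁ g' w')
    U-pair-≈ f g f' g' w w' =
      (λ e → ≈-trans (≈-sym (π₁-pair f g w)) (≈-trans (U₁-cong π₁ e) (π₁-pair f' g' w')) ,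
             ≈-trans (≈-sym (π₂-pair f g w)) (≈-trans (U₁-cong π₂ e) (π₂-pair f' g' w'))) ,
      (λ (e₁ , e₂) → π-≈-reflect _ _ (≈-trans (π₁-pair f g w) (≈-trans e₁ (≈-sym (π₁-pair f' g' w'))))
                                     (≈-trans (π₂-pair f g w) (≈-trans e₂ (≈-sym (π₂-pair f' g' w')))))

  product : ∀ Y Z → BinaryProduct Y Z
  product Y Z with pullback (! {Y}) (! {Z})
  ... | P , π₁ , π₂ , isPullback@(_ , universal , _) = record
    { P = P ; π₁ = π₁ ; π₂ = π₂ ; pair = pair
    ; π₁-pair = λ f g w → ≈-trans (≈-sym (U-∘ π₁ (pair f g) w)) (U₁-resp-≈ (proj₁ (π-pair f g)) w)
    ; π₂-pair = λ f g w → ≈-trans (≈-sym (U-∘ π₂ (pair f g) w)) (U₁-resp-≈ (proj₂ (π-pair f g)) w)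
    ; point = λ y z → proj₁ (proj₂ tab) y z (⊤-points-≈ _ _)
    ; π-reflect = proj₂ (proj₂ tab)
    }
    where
      tab : Tabulates (λ y z → U₁ ! y ≈ᵤ U₁ ! z) π₁ π₂
      tab = U-pullback isPullback

      pair : ∀ {W} → Hom W Y → Hom W Z → Hom W P
      pair f g = proj₁ (universal f g (!-unique _ _))

      π-pair : ∀ {W} (f : Hom W Y) (g : Hom W Z) → π₁ ∘ pair f g ≈ f × π₂ ∘ pair f g ≈ g
      π-pair f g = proj₁ (proj₂ (universal f g (!-unique _ _)))

  record SpanWitnesses {V K B D} (t₁ : Hom V B) (t₂ : Hom V D) (u : Hom K B) (v : Hom K D) : Set (o ⊔ ℓ) where
    field
      L : Obj
      σ : Hom L V
      τ : Hom L K
      left : ∀ l → U₁ t₁ (U₁ σ l) ≤ᵤ U₁ u (U₁ τ l)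
      right : ∀ l → U₁ v (U₁ τ l) ≤ᵤ U₁ t₂ (U₁ σ l)
      lift : ∀ x k → U₁ t₁ x ≤ᵤ U₁ u k → U₁ v k ≤ᵤ U₁ t₂ x →
             Σ[ l ∈ ∣ U₀ L ∣ ] U₁ σ l ≈ᵤ x

  spanWitnesses : ∀ {V K B D} (t₁ : Hom V B) (t₂ : Hom V D) (u : Hom K B) (v : Hom K D) →
                  SpanWitnesses t₁ t₂ u v
  spanWitnesses {V} {K} t₁ t₂ u v
    with comma t₁ u | comma v t₂
  ... | _ , c₁ , c₂ , isComma₁ | _ , d₁ , d₂ , isComma₂
    with pullback (BinaryProduct.pair (product V K) c₁ c₂) (BinaryProduct.pair (product V K) d₂ d₁)
  ... | L , l₁ , l₂ , isPullback = record
    { L = L ; σ = c₁ ∘ l₁ ; τ = c₂ ∘ l₁ ; left = left ; right = right ; lift = lift }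
    where
      open BinaryProduct (product V K)
      open ≤-Reasoning

      tab₁ : Tabulates (commaRel t₁ u) c₁ c₂
      tab₁ = U-comma isComma₁

      tab₂ : Tabulates (commaRel v t₂) d₁ d₂
      tab₂ = U-comma isComma₂

      tabL : Tabulates (λ y z → U₁ (pair c₁ c₂) y ≈ᵤ U₁ (pair d₂ d₁) z) l₁ l₂
      tabL = U-pullback isPullback

      agree : ∀ l → U₁ c₁ (U₁ l₁ l) ≈ᵤ U₁ d₂ (U₁ l₂ l) × U₁ c₂ (U₁ l₁ l) ≈ᵤ U₁ d₁ (U₁ l₂ l)
      agree l = proj₁ (U-pair-≈ c₁ c₂ d₂ d₁ _ _) (proj₁ tabL l)

      left : ∀ l → U₁ t₁ (U₁ (c₁ ∘ l₁) l) ≤ᵤ U₁ u (U₁ (c₂ ∘ l₁) l)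
      left l = begin
        U₁ t₁ (U₁ (c₁ ∘ l₁) l)  ≈⟨ U₁-cong t₁ (U-∘ c₁ l₁ l) ⟩
        U₁ t₁ (U₁ c₁ (U₁ l₁ l)) ≤⟨ proj₁ tab₁ (U₁ l₁ l) ⟩
        U₁ u (U₁ c₂ (U₁ l₁ l))  ≈⟨ U₁-cong u (≈-sym (U-∘ c₂ l₁ l)) ⟩
        U₁ u (U₁ (c₂ ∘ l₁) l)   ∎

      right : ∀ l → U₁ v (U₁ (c₂ ∘ l₁) l) ≤ᵤ U₁ t₂ (U₁ (c₁ ∘ l₁) l)
      right l = begin
        U₁ v (U₁ (c₂ ∘ l₁) l)   ≈⟨ U₁-cong v (≈-trans (U-∘ c₂ l₁ l) (proj₂ (agree l))) ⟩
        U₁ v (U₁ d₁ (U₁ l₂ l))  ≤⟨ proj₁ tab₂ (U₁ l₂ l) ⟩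
        U₁ t₂ (U₁ d₂ (U₁ l₂ l)) ≈⟨ U₁-cong t₂ (≈-sym (≈-trans (U-∘ c₁ l₁ l) (proj₁ (agree l)))) ⟩
        U₁ t₂ (U₁ (c₁ ∘ l₁) l)  ∎

      lift : ∀ x k → U₁ t₁ x ≤ᵤ U₁ u k → U₁ v k ≤ᵤ U₁ t₂ x →
             Σ[ l ∈ ∣ U₀ L ∣ ] U₁ (c₁ ∘ l₁) l ≈ᵤ x
      lift x k t₁x≤uk vk≤t₂x
        with proj₁ (proj₂ tab₁) x k t₁x≤uk | proj₁ (proj₂ tab₂) k x vk≤t₂x
      ... | y , c₁y≈x , c₂y≈k | z , d₁z≈k , d₂z≈x
        with proj₁ (proj₂ tabL) y z
               (proj₂ (U-pair-≈ c₁ c₂ d₂ d₁ y z)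
                 (≈-trans c₁y≈x (≈-sym d₂z≈x) , ≈-trans c₂y≈k (≈-sym d₁z≈k)))
      ... | l , l₁l≈y , _ = l , ≈-trans (U₁-∘-≈ c₁ l₁ l₁l≈y) c₁y≈x

  image-tabulates : ∀ {L P B D} {R : PRel (U₀ B) (U₀ D)} (f : Hom L P) (a : Hom P B) (b : Hom P D) →
    (∀ x x' → U₁ a x ≤ᵤ U₁ a x' → U₁ b x ≤ᵤ U₁ b x' → x ≤ᵤ x') →
    IsWeakening (U₀ B) (U₀ D) R →
    (∀ l → R (U₁ a (U₁ f l)) (U₁ b (U₁ f l))) →
    (∀ y z → R y z → Σ[ l ∈ ∣ U₀ L ∣ ] (U₁ a (U₁ f l) ≈ᵤ y × U₁ b (U₁ f l) ≈ᵤ z)) →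
    Σ[ M ∈ Obj ] Σ[ p ∈ Hom M B ] Σ[ q ∈ Hom M D ] Tabulates R p q
  image-tabulates {R = R} f a b ab-reflect weak f∈R onto-R with factorise f
  ... | M , e , m , e-surj , m-emb , m∘e≈f = M , a ∘ m , b ∘ m , in-R , onto , reflect
    where
      m-e : ∀ {i l} → U₁ e l ≈ᵤ i → U₁ m i ≈ᵤ U₁ f l
      m-e {i} {l} el≈i =
        ≈-trans (U₁-cong m (≈-sym el≈i)) (≈-trans (≈-sym (U-∘ m e l)) (U₁-resp-≈ m∘e≈f l))

      in-R : ∀ i → R (U₁ (a ∘ m) i) (U₁ (b ∘ m) i)
      in-R i with e-surj i
      ... | l , el≈i =
        weak (≤-reflexive (U₁-∘-≈ a m (m-e el≈i))) (f∈R l) (≥-reflexive (U₁-∘-≈ b m (m-e el≈i)))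

      onto : ∀ y z → R y z → Σ[ i ∈ ∣ U₀ M ∣ ] (U₁ (a ∘ m) i ≈ᵤ y × U₁ (b ∘ m) i ≈ᵤ z)
      onto y z r with onto-R y z r
      ... | l , afl≈y , bfl≈z = U₁ e l , ≈-trans (U₁-∘-≈ a m (m-e ≈-refl)) afl≈y
                                       , ≈-trans (U₁-∘-≈ b m (m-e ≈-refl)) bfl≈z

      reflect : ∀ i i' → U₁ (a ∘ m) i ≤ᵤ U₁ (a ∘ m) i' → U₁ (b ∘ m) i ≤ᵤ U₁ (b ∘ m) i' → i ≤ᵤ i'
      reflect i i' ≤a ≤b = m-emb i i' (ab-reflect _ _
        (≤-trans (≥-reflexive (U-∘ a m i)) (≤-trans ≤a (≤-reflexive (U-∘ a m i'))))
        (≤-trans (≥-reflexive (U-∘ b m i)) (≤-trans ≤b (≤-reflexive (U-∘ b m i')))))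

  -- Abstract: nothing depends on how these witnesses compute, and unfolding them is costly.
  abstract
    commaRel-isCRel : ∀ {B D E} (f : Hom B E) (g : Hom D E) → IsCRel (commaRel f g)
    commaRel-isCRel f g with comma f g
    ... | K , k₁ , k₂ , isComma =
      (λ a'≤a fa≤gb b≤b' → ≤-trans (U₁-mono f a'≤a) (≤-trans fa≤gb (U₁-mono g b≤b'))) ,
      K , k₁ , k₂ , U-comma isComma

    spanRel-isCRel : ∀ {K B D} (u : Hom K B) (v : Hom K D) → IsCRel (spanRel u v)
    spanRel-isCRel {B = B} {D} u v =
      spanRel-weakening u v ,
      image-tabulates σ π₁ π₂ π-reflect (spanRel-weakening u v) (λ l → U₁ τ l , left l , right l) onto
      where
        open BinaryProduct (product B D)
        open SpanWitnesses (spanWitnesses π₁ π₂ u v)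

        onto : ∀ b d → spanRel u v b d →
               Σ[ l ∈ ∣ U₀ L ∣ ] (U₁ π₁ (U₁ σ l) ≈ᵤ b × U₁ π₂ (U₁ σ l) ≈ᵤ d)
        onto b d (k , b≤uk , vk≤d) with point b d
        ... | x , π₁x≈b , π₂x≈d
          with lift x k (≤-trans (≤-reflexive π₁x≈b) b≤uk) (≤-trans vk≤d (≥-reflexive π₂x≈d))
        ... | l , σl≈x = l , ≈-trans (U₁-cong π₁ σl≈x) π₁x≈b , ≈-trans (U₁-cong π₂ σl≈x) π₂x≈d

    ₊-isCRel : ∀ {B D} (f : Hom B D) → IsCRel (f ₊)
    ₊-isCRel f = isCRel-resp-≃ (≃-sym (₊-≃-spanRel f)) (spanRel-isCRel id f)

    ⁺-isCRel : ∀ {B D} (f : Hom B D) → IsCRel (f ⁺)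
    ⁺-isCRel f = isCRel-resp-≃ (≃-sym (⁺-≃-spanRel f)) (spanRel-isCRel f id)

  composite-≃-spanRel :
    ∀ {W W' K B C D} {R : PRel (U₀ B) (U₀ C)} {S : PRel (U₀ C) (U₀ D)}
      {p : Hom W B} {q : Hom W C} {p' : Hom W' C} {q' : Hom W' D} {k₁ : Hom K W} {k₂ : Hom K W'} →
    IsWeakening (U₀ B) (U₀ C) R → Tabulates R p q →
    IsWeakening (U₀ C) (U₀ D) S → Tabulates S p' q' →
    IsComma q p' k₁ k₂ → S ·ᵤ R ≃ᵤ spanRel (p ∘ k₁) (q' ∘ k₂)
  composite-≃-spanRel {R = R} {S} {p} {q} {p'} {q'} {k₁} {k₂}
                      weakR (pq∈R , ontoR , _) weakS (pq∈S , ontoS , _) isComma = ⊆ , ⊇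
    where
      tabK : Tabulates (commaRel q p') k₁ k₂
      tabK = U-comma isComma

      ⊆ : ∀ b d → (S ·ᵤ R) b d → spanRel (p ∘ k₁) (q' ∘ k₂) b d
      ⊆ b d (c , bRc , cSd) with ontoR b c bRc | ontoS c d cSd
      ... | w , pw≈b , qw≈c | w' , p'w'≈c , q'w'≈d
        with proj₁ (proj₂ tabK) w w' (≤-trans (≤-reflexive qw≈c) (≥-reflexive p'w'≈c))
      ... | k , k₁k≈w , k₂k≈w' = k , ≥-reflexive (≈-trans (U₁-∘-≈ p k₁ k₁k≈w) pw≈b)
                                   , ≤-reflexive (≈-trans (U₁-∘-≈ q' k₂ k₂k≈w') q'w'≈d)

      ⊇ : ∀ b d → spanRel (p ∘ k₁) (q' ∘ k₂) b d → (S ·ᵤ R) b d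
      ⊇ b d (k , b≤pk₁k , q'k₂k≤d) =
        U₁ q (U₁ k₁ k) ,
        weakR (≤-trans b≤pk₁k (≤-reflexive (U-∘ p k₁ k))) (pq∈R (U₁ k₁ k)) ≤-refl ,
        weakS (proj₁ tabK k) (pq∈S (U₁ k₂ k)) (≤-trans (≥-reflexive (U-∘ q' k₂ k)) q'k₂k≤d)

module RelationalImage {o ℓ} {X A : OrderRegular o ℓ} (F : ContraFunctor X A) where
  private
    module X = OrderRegularProperties X
    module A = OrderRegularProperties A
  open ContraFunctor F

  F[_] : ∀ {B C} → X.Hom B C → ∣ A.U₀ (F₀ C) ∣ → ∣ A.U₀ (F₀ B) ∣
  F[ f ] = A.U₁ (F₁ f)

  F[∘] : ∀ {B C D} (g : X.Hom C D) (f : X.Hom B C) a → F[ g X.∘ f ] a A.≈ᵤ F[ f ] (F[ g ] a)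
  F[∘] g f a = A.≈-trans (A.U₁-resp-≈ (F-∘ g f) a) (A.U-∘ (F₁ f) (F₁ g) a)

  F[id] : ∀ {B} a → F[ X.id {B} ] a A.≈ᵤ a
  F[id] a = A.≈-trans (A.U₁-resp-≈ F-id a) (A.U-id a)

  F[]-mono : ∀ {B C} {f g : X.Hom B C} → f X.≤ g → ∀ a → F[ f ] a A.≤ᵤ F[ g ] a
  F[]-mono f≤g = A.U-preserves-≤ (F-mono f≤g)

  -- F̄ u v is the paper's F̄ r for the relation r tabulated by (u , v).
  F̄ : ∀ {K B D} → X.Hom K B → X.Hom K D → PRel (A.U₀ (F₀ B)) (A.U₀ (F₀ D))
  F̄ u v = A.commaRel (F₁ u) (F₁ v)

  F̄-id : ∀ {B D} (f : X.Hom B D) → F̄ X.id f A.≃ᵤ F₁ f A.⁺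
  F̄-id f = (λ a b ida≤fb → A.≤-trans (A.≥-reflexive (F[id] a)) ida≤fb) ,
           (λ a b a≤fb → A.≤-trans (A.≤-reflexive (F[id] a)) a≤fb)

  F-id⁺-≃-idRel : ∀ {B} → F₁ (X.id {B}) A.⁺ A.≃ᵤ idRel (A.U₀ (F₀ B))
  F-id⁺-≃-idRel = (λ a b a≤idb → A.≤-trans a≤idb (A.≤-reflexive (F[id] b))) ,
                  (λ a b a≤b → A.≤-trans a≤b (A.≥-reflexive (F[id] b)))

  F̄-∘ : ∀ {K B D W W'} (u : X.Hom W B) (v : X.Hom W' D) (k₁ : X.Hom K W) (k₂ : X.Hom K W') a d →
        F̄ (u X.∘ k₁) (v X.∘ k₂) a d iff F̄ k₁ k₂ (F[ u ] a) (F[ v ] d)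
  F̄-∘ u v k₁ k₂ a d =
    (λ le → A.≤-trans (A.≥-reflexive (F[∘] u k₁ a)) (A.≤-trans le (A.≤-reflexive (F[∘] v k₂ d)))) ,
    (λ le → A.≤-trans (A.≤-reflexive (F[∘] u k₁ a)) (A.≤-trans le (A.≥-reflexive (F[∘] v k₂ d))))

  comma-isExact : ∀ {K W W' C} {k₁ : X.Hom K W} {k₂ : X.Hom K W'} {f : X.Hom W C} {g : X.Hom W' C} →
                  X.IsComma f g k₁ k₂ → IsExact F k₁ k₂ f g
  comma-isExact isComma@(fk₁≤gk₂ , _) = fk₁≤gk₂ , λ x y fx≤gy →
    let (k , k₁k≈x , k₂k≈y) = proj₁ (proj₂ (X.U-comma isComma)) x y fx≤gy
    in k , X.≥-reflexive k₁k≈x , X.≤-reflexive k₂k≈y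

  F̄-exact : PreservesExact F →
            ∀ {K W W' C} {k₁ : X.Hom K W} {k₂ : X.Hom K W'} {f : X.Hom W C} {g : X.Hom W' C} →
            IsExact F k₁ k₂ f g → F̄ k₁ k₂ A.≃ᵤ F₁ g A.₊ A.·ᵤ F₁ f A.⁺
  F̄-exact preservesExact {k₁ = k₁} {k₂} {f} {g} exact =
    A.≃-trans (A.≃-sym (A.⁺·₊-≃-commaRel (F₁ k₁) (F₁ k₂))) (preservesExact k₁ k₂ f g exact)

  module _ {G : RelMap F} (extension : IsExtension F G) where
    open IsExtension extension

    private
      Ĝ : ∀ {B C} (R : PRel (X.U₀ B) (X.U₀ C)) → X.IsCRel R → PRel (A.U₀ (F₀ B)) (A.U₀ (F₀ C))
      Ĝ R r = proj₁ (G R r)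

      extends₊ : ∀ {B C} (f : X.Hom B C) → Ĝ (f X.₊) (X.₊-isCRel f) A.≃ᵤ F₁ f A.⁺
      extends₊ f = extends f (f X.₊) (X.₊-isCRel f) (X.≃-refl {R = f X.₊})

      pres-id₊ : ∀ {B} → Ĝ (X.id {B} X.₊) (X.₊-isCRel (X.id {B})) A.≃ᵤ idRel (A.U₀ (F₀ B))
      pres-id₊ {B} = pres-id (X.id {B} X.₊) (X.₊-isCRel (X.id {B})) (X.id₊-≃-idRel {B})

    -- G preserves the adjunction p₊ ⊣ p⁺, and the right adjoint of (F p)⁺ is (F p)₊.
    extension-⁺ : ∀ {W B} (p : X.Hom W B) → Ĝ (p X.⁺) (X.⁺-isCRel p) A.≃ᵤ F₁ p A.₊
    extension-⁺ {W} {B} p = counit , unit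
      where
        p⁺·p₊ : Ĝ (X.commaRel p p) (X.commaRel-isCRel p p)
                  A.≃ᵤ Ĝ (p X.⁺) (X.⁺-isCRel p) A.·ᵤ Ĝ (p X.₊) (X.₊-isCRel p)
        p⁺·p₊ = pres-∘ (p X.₊) (p X.⁺) (X.commaRel p p)
                       (X.₊-isCRel p) (X.⁺-isCRel p) (X.commaRel-isCRel p p)
                       (X.≃-sym (X.⁺·₊-≃-commaRel p p))

        p₊·p⁺ : Ĝ (X.spanRel p p) (X.spanRel-isCRel p p)
                  A.≃ᵤ Ĝ (p X.₊) (X.₊-isCRel p) A.·ᵤ Ĝ (p X.⁺) (X.⁺-isCRel p)
        p₊·p⁺ = pres-∘ (p X.⁺) (p X.₊) (X.spanRel p p)
                       (X.⁺-isCRel p) (X.₊-isCRel p) (X.spanRel-isCRel p p) X.≃-refl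

        id⊆p⁺·p₊ : X.id {W} X.₊ X.⊆ᵤ X.commaRel p p
        id⊆p⁺·p₊ w w' idw≤w' = X.U₁-mono p (proj₁ X.id₊-≃-idRel w w' idw≤w')

        p₊·p⁺⊆id : X.spanRel p p X.⊆ᵤ X.id {B} X.₊
        p₊·p⁺⊆id b b' (_ , b≤pw , pw≤b') = proj₂ X.id₊-≃-idRel b b' (X.≤-trans b≤pw pw≤b')

        counit : ∀ γ β → Ĝ (p X.⁺) (X.⁺-isCRel p) γ β → F[ p ] γ A.≤ᵤ β
        counit γ β γβ = proj₁ pres-id₊ _ _
          (mono (X.id X.₊) (X.commaRel p p) (X.₊-isCRel X.id) (X.commaRel-isCRel p p) id⊆p⁺·p₊ _ _
            (proj₂ p⁺·p₊ _ _ (γ , proj₂ (extends₊ p) _ _ A.≤-refl , γβ)))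

        unit : ∀ γ β → F[ p ] γ A.≤ᵤ β → Ĝ (p X.⁺) (X.⁺-isCRel p) γ β
        unit γ β pγ≤β with proj₁ p₊·p⁺ γ γ
                             (mono (X.spanRel p p) (X.id X.₊) (X.spanRel-isCRel p p) (X.₊-isCRel X.id)
                                   p₊·p⁺⊆id γ γ (proj₂ pres-id₊ γ γ A.≤-refl))
        ... | δ , γδ , δγ = proj₁ (proj₂ (G (p X.⁺) (X.⁺-isCRel p))) A.≤-refl γδ
                              (A.≤-trans (proj₁ (extends₊ p) δ γ δγ) pγ≤β)

    extension-on-tabulated : ∀ {W B C} {R : PRel (X.U₀ B) (X.U₀ C)} (r : X.IsCRel R)
                               {p : X.Hom W B} {q : X.Hom W C} →
                             X.Tabulates R p q → Ĝ R r A.≃ᵤ F̄ p q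
    extension-on-tabulated {R = R} r {p} {q} tab =
      A.≃-trans (pres-∘ (p X.⁺) (q X.₊) R (X.⁺-isCRel p) (X.₊-isCRel q) r
                        (X.tabulated-≃-spanRel (proj₁ r) tab))
     (A.≃-trans (A.·-cong (extension-⁺ p) (extends₊ q))
                (A.⁺·₊-≃-commaRel (F₁ p) (F₁ q)))

module Extension {o ℓ} {X A : OrderRegular o ℓ} (F : ContraFunctor X A) (surjToEmb : SurjToEmb F) where
  private
    module X = OrderRegularProperties X
    module A = OrderRegularProperties A
  open ContraFunctor F
  open RelationalImage F

  -- F σ is an order embedding because the witness projection σ is surjective.
  F̄-antitone : ∀ {V K B D} {t₁ : X.Hom V B} {t₂ : X.Hom V D} {u : X.Hom K B} {v : X.Hom K D} →
               X.SpanIn (X.spanRel u v) t₁ t₂ → F̄ u v A.⊆ᵤ F̄ t₁ t₂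
  F̄-antitone {t₁ = t₁} {t₂} {u} {v} t∈uv a d ua≤vd =
    surjToEmb σ σ-surjective (F[ t₁ ] a) (F[ t₂ ] d) (begin
      F[ σ ] (F[ t₁ ] a) ≈⟨ A.≈-sym (F[∘] t₁ σ a) ⟩
      F[ t₁ X.∘ σ ] a    ≤⟨ F[]-mono (X.∘-≤-pointwise left) a ⟩
      F[ u X.∘ τ ] a     ≈⟨ F[∘] u τ a ⟩
      F[ τ ] (F[ u ] a)  ≤⟨ A.U₁-mono (F₁ τ) ua≤vd ⟩
      F[ τ ] (F[ v ] d)  ≈⟨ A.≈-sym (F[∘] v τ d) ⟩
      F[ v X.∘ τ ] d     ≤⟨ F[]-mono (X.∘-≤-pointwise right) d ⟩
      F[ t₂ X.∘ σ ] d    ≈⟨ F[∘] t₂ σ d ⟩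
      F[ σ ] (F[ t₂ ] d) ∎)
    where
      open X.SpanWitnesses (X.spanWitnesses t₁ t₂ u v)
      open A.≤-Reasoning

      σ-surjective : X.Surj σ
      σ-surjective x = let (k , t₁x≤uk , vk≤t₂x) = t∈uv x in lift x k t₁x≤uk vk≤t₂x

  F̄-cong : ∀ {V K B D} {T : PRel (X.U₀ B) (X.U₀ D)} {t₁ : X.Hom V B} {t₂ : X.Hom V D}
             {u : X.Hom K B} {v : X.Hom K D} →
           X.Tabulates T t₁ t₂ → T X.≃ᵤ X.spanRel u v → F̄ t₁ t₂ A.≃ᵤ F̄ u v
  F̄-cong {u = u} {v} tab (T⊆uv , uv⊆T) =
    F̄-antitone (λ k → X.tabulated⊆spanRel tab _ _ (uv⊆T _ _ (X.spanRel-refl u v k))) ,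
    F̄-antitone (λ x → T⊆uv _ _ (proj₁ tab x))

  G : RelMap F
  G R (_ , _ , p , q , _) = F̄ p q , A.commaRel-isCRel (F₁ p) (F₁ q)

  private
    ≃⇒iff : ∀ {B D} {R S : PRel (A.U₀ B) (A.U₀ D)} → R A.≃ᵤ S → ∀ a b → R a b iff S a b
    ≃⇒iff (R⊆S , S⊆R) a b = R⊆S a b , S⊆R a b

  G-on-tabulated : ∀ {W B C} {R : PRel (X.U₀ B) (X.U₀ C)} (r : X.IsCRel R) {p : X.Hom W B} {q : X.Hom W C} →
                   X.Tabulates R p q → proj₁ (G R r) A.≃ᵤ F̄ p q
  G-on-tabulated (weak , _ , _ , _ , tab₀) tab = F̄-cong tab₀ (X.tabulated-≃-spanRel weak tab)

  G-described : Described F G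
  G-described R r p q tab = ≃⇒iff (G-on-tabulated r tab)

  G-commaTabulated : CommaTabulated F G
  G-commaTabulated R r p q tab k₁ k₂ isComma =
    A.Tabulates-resp-≃ (A.≃-sym (G-on-tabulated r tab)) (A.U-comma isComma)

  G-lowerStar : ∀ {B C} (f : X.Hom B C) (R : PRel (X.U₀ B) (X.U₀ C)) (r : X.IsCRel R) →
                R X.≃ᵤ f X.₊ → proj₁ (G R r) A.≃ᵤ F₁ f A.⁺
  G-lowerStar f R (weak , _ , _ , _ , tab₀) R≃f₊ =
    A.≃-trans (F̄-cong tab₀ (X.≃-trans R≃f₊ (X.₊-≃-spanRel f))) (F̄-id f)

  G-lowerStarDescribed : LowerStarDescribed F G
  G-lowerStarDescribed f R r R≃f₊ = ≃⇒iff (G-lowerStar f R r R≃f₊)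

  G-pres-∘ : PreservesExact F →
             ∀ {B C D} (R : PRel (X.U₀ B) (X.U₀ C)) (S : PRel (X.U₀ C) (X.U₀ D)) (T : PRel (X.U₀ B) (X.U₀ D))
               (r : X.IsCRel R) (s : X.IsCRel S) (t : X.IsCRel T) →
             T X.≃ᵤ S X.·ᵤ R → proj₁ (G T t) A.≃ᵤ proj₁ (G S s) A.·ᵤ proj₁ (G R r)
  G-pres-∘ preservesExact R S T (weakR , _ , p , q , tabR) (weakS , _ , p' , q' , tabS) (_ , _ , _ , _ , tabT) T≃SR
    with X.comma q p'
  ... | _ , k₁ , k₂ , isComma =
    A.≃-trans (F̄-cong tabT (X.≃-trans T≃SR (X.composite-≃-spanRel weakR tabR weakS tabS isComma)))
              ((λ a d le → proj₁ exact _ _ (proj₁ (F̄-∘ p q' k₁ k₂ a d) le)) ,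
               (λ a d c → proj₂ (F̄-∘ p q' k₁ k₂ a d) (proj₂ exact _ _ c)))
    where
      exact : F̄ k₁ k₂ A.≃ᵤ F₁ p' A.₊ A.·ᵤ F₁ q A.⁺
      exact = F̄-exact preservesExact (comma-isExact isComma)

  G-isExtension : PreservesExact F → IsExtension F G
  G-isExtension preservesExact = record
    { mono = λ R R' r r' R⊆R' →
        F̄-antitone (λ w → X.tabulated⊆spanRel (tabulation r') _ _ (R⊆R' _ _ (proj₁ (tabulation r) w)))
    ; pres-id = λ R r R≃id →
        A.≃-trans (G-lowerStar X.id R r (X.≃-trans R≃id (X.≃-sym X.id₊-≃-idRel))) F-id⁺-≃-idRel
    ; pres-∘ = G-pres-∘ preservesExact
    ; extends = G-lowerStar
    }
    where
      tabulation : ∀ {B C} {R : PRel (X.U₀ B) (X.U₀ C)} (r : X.IsCRel R) →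
                   X.Tabulates R (proj₁ (proj₂ (proj₂ r))) (proj₁ (proj₂ (proj₂ (proj₂ r))))
      tabulation r = proj₂ (proj₂ (proj₂ (proj₂ r)))

  G-unique : ∀ {G' : RelMap F} → IsExtension F G' →
             ∀ {B C} (R : PRel (X.U₀ B) (X.U₀ C)) (r : X.IsCRel R) → proj₁ (G' R r) A.≃ᵤ proj₁ (G R r)
  G-unique extension R r@(_ , _ , _ , _ , tab₀) = extension-on-tabulated extension r tab₀

proposition7p1 : ∀ {o ℓ : Level} (X A : OrderRegular o ℓ) (F : ContraFunctor X A) →
    PreservesExact F → SurjToEmb F →
    Σ[ G ∈ RelMap F ]
      (IsExtension F G ×
       (∀ (G' : RelMap F) → IsExtension F G' →
          ∀ {B C} (R : PRel (OrderRegular.U₀ X B) (OrderRegular.U₀ X C))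
            (r : OrderRegular.IsCRel X R) →
          _≃_ (OrderRegular.U₀ A (ContraFunctor.F₀ F B)) (OrderRegular.U₀ A (ContraFunctor.F₀ F C))
            (proj₁ (G' R r)) (proj₁ (G R r))) ×
       Described F G × CommaTabulated F G × LowerStarDescribed F G)
proposition7p1 X A F preservesExact surjToEmb =
  G , G-isExtension preservesExact , (λ G' → G-unique {G'}) ,
  G-described , G-commaTabulated , G-lowerStarDescribed
  where open Extension F surjToEmb
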